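{- In a three-machine permutation flowshop where all processing times are integers satisfying $p_{ij}\le M$ for all jobs $i$ and machines $j$, for any job set $S'$ of $t$ jobs the number of non-dominated criteria vectors $\langle C^M_2,C^M_3\rangle$ among the Pareto permutations of $S'$ is at most $(t+1)M$, i.e. $O^*(M)$.
   Context: Three-machine flowshop: each job $i$ has non-negative integer processing times $p_{i1},p_{i2},p_{i3}$ on machines 1, 2, 3, processed in that order; each machine processes one job at a time. A permutation $\pi$ of jobs is scheduled from time $0$ as a permutation schedule (same order on all machines, every operation as early as possible); $C^M_j(\pi)$ is the completion time of the last job of $\pi$ on machine $j$. The criteria vector of $\pi$ is $\langle C^M_2(\pi),C^M_3(\pi)\rangle$. The Pareto permutations of $S'$ are the permutations of $S'$ whose criteria vector is not dominated by that of another permutation of $S'$ (one representative kept per vector). Notation: $f=O^*(g)$ means $f=O(p\cdot g)$ for some polynomial $p$ in $t$. -}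

module Defs where

open import Data.Nat using (ℕ; zero; suc; _+_; _*_; _≤_; _⊔_)
open import Data.Product using (_×_; _,_; ∃; Σ)
open import Data.List using (List; []; _∷_)
open import Data.List.Relation.Binary.Permutation.Propositional using (_↭_)
open import Relation.Binary.PropositionalEquality using (_≡_)
open import Relation.Nullary using (¬_)

-- A job: processing times ⟨p₁ , p₂ , p₃⟩ on machines 1, 2, 3.
Job : Set
Job = ℕ × ℕ × ℕ

Bounded : ℕ → Job → Set
Bounded M (p₁ , p₂ , p₃) = p₁ ≤ M × p₂ ≤ M × p₃ ≤ M

-- Machine-state after scheduling a prefix: completion times of the last
-- scheduled job on machines 1, 2, 3 (all operations as early as possible).
State : Set
State = ℕ × ℕ × ℕ

step : State → Job → State
step (c₁ , c₂ , c₃) (p₁ , p₂ , p₃) =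
  let d₁ = c₁ + p₁
      d₂ = (d₁ ⊔ c₂) + p₂
      d₃ = (d₂ ⊔ c₃) + p₃
  in d₁ , d₂ , d₃

run : State → List Job → State
run s [] = s
run s (j ∷ π) = run (step s j) π

schedule : List Job → State
schedule π = run (0 , 0 , 0) π

criteria : List Job → ℕ × ℕ
criteria π with schedule π
... | (_ , c₂ , c₃) = c₂ , c₃

Dominates : ℕ × ℕ → ℕ × ℕ → Set
Dominates (a , b) (c , d) = a ≤ c × b ≤ d × ¬ ((a , b) ≡ (c , d))

ParetoVector : List Job → ℕ × ℕ → Set
ParetoVector S v =
  Σ (List Job) (λ π → π ↭ S × criteria π ≡ v)
  × ((π′ : List Job) → π′ ↭ S → ¬ Dominates (criteria π′) v)

-- The first criterion C₂ of every permutation of S lies between Σ p₂ (machine 2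
-- is busy for at least that long) and Σ (p₁ + p₂) ≤ Σ p₂ + tM (machine 2 never
-- finishes later than it would if every job were run alone through machines 1
-- and 2 one after the other). So C₂ takes at most tM + 1 values, and two
-- distinct non-dominated vectors cannot share their first coordinate.
module Submission where

open import Defs
open import Data.Nat using (ℕ; suc; _+_; _*_; _∸_; _≤_; _<_; _⊔_; s≤s)
open import Data.Nat.Properties
open import Data.Nat.ListAction using (sum)
open import Data.Nat.ListAction.Properties using (sum-↭)
open import Algebra.Properties.CommutativeSemigroup +-commutativeSemigroup
  using (interchange)
open import Data.Product using (_×_; _,_; proj₁; proj₂)
open import Data.Sum using (inj₁; inj₂)
open import Data.Empty using (⊥-elim)
open import Data.Fin using (Fin; zero; suc; toℕ; fromℕ<)
open import Data.Fin.Properties using (injective⇒≤; toℕ-fromℕ<)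
open import Data.List using (List; []; _∷_; length; map; lookup)
open import Data.List.Properties using (length-map)
open import Data.List.Membership.Propositional.Properties using (∈-lookup)
open import Data.List.Relation.Unary.All as All using (All; []; _∷_)
open import Data.List.Relation.Unary.All.Properties using (map⁺)
open import Data.List.Relation.Unary.AllPairs using ([]; _∷_)
open import Data.List.Relation.Unary.Unique.Propositional using (Unique)
import Data.List.Relation.Binary.Permutation.Propositional.Properties as ↭
open import Function using (_∘_)
open import Function.Definitions using (Injective)
open import Relation.Binary.PropositionalEquality
open import Relation.Nullary using (¬_; yes; no)

lookup-injective : ∀ {A : Set} {xs : List A} → Unique xs →
  ∀ {i j} → lookup xs i ≡ lookup xs j → i ≡ j
lookup-injective (_ ∷ _)     {zero}  {zero}  _  = refl
lookup-injective (x∉xs ∷ _)  {zero}  {suc j} eq = ⊥-elim (All.lookup x∉xs (∈-lookup j) eq)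
lookup-injective (x∉xs ∷ _)  {suc i} {zero}  eq = ⊥-elim (All.lookup x∉xs (∈-lookup i) (sym eq))
lookup-injective (_ ∷ xs!)   {suc i} {suc j} eq = cong suc (lookup-injective xs! eq)

unique-<-length : ∀ {n} {ns : List ℕ} → Unique ns → All (_< n) ns → length ns ≤ n
unique-<-length {n} {ns} ns! ns<n = injective⇒≤ {f = index} index-injective
  where
  index : Fin (length ns) → Fin n
  index i = fromℕ< (All.lookup ns<n (∈-lookup i))

  index-injective : Injective _≡_ _≡_ index
  index-injective {i} {j} eq = lookup-injective ns! (begin
    lookup ns i      ≡⟨ toℕ-fromℕ< _ ⟨
    toℕ (index i)    ≡⟨ cong toℕ eq ⟩
    toℕ (index j)    ≡⟨ toℕ-fromℕ< _ ⟩
    lookup ns j      ∎)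
    where open ≡-Reasoning

map⁺-injectiveOn : ∀ {A B : Set} {P : A → Set} {f : A → B} →
  (∀ {x y} → P x → P y → f x ≡ f y → x ≡ y) →
  ∀ {xs} → All P xs → Unique xs → Unique (map f xs)
map⁺-injectiveOn inj []         []           = []
map⁺-injectiveOn inj (px ∷ pxs) (x∉xs ∷ xs!) =
  map⁺ (All.zipWith (λ (py , x≢y) → x≢y ∘ inj px py) (pxs , x∉xs))
  ∷ map⁺-injectiveOn inj pxs xs!

time₁ time₂ workload : Job → ℕ
time₁ (p₁ , _ , _) = p₁
time₂ (_ , p₂ , _) = p₂
workload j = time₁ j + time₂ j

C₂ : State → ℕ
C₂ (_ , c₂ , _) = c₂

-- max(C₁, C₂) grows by at most p₁ + p₂ per job; this is the upper bound on C₂.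
front : State → ℕ
front (c₁ , c₂ , _) = c₁ ⊔ c₂

C₂-step-≥ : ∀ s j → C₂ s + time₂ j ≤ C₂ (step s j)
C₂-step-≥ (c₁ , c₂ , _) (p₁ , p₂ , _) = +-monoˡ-≤ p₂ (m≤n⊔m (c₁ + p₁) c₂)

C₂-run-≥ : ∀ s π → C₂ s + sum (map time₂ π) ≤ C₂ (run s π)
C₂-run-≥ s []      = ≤-reflexive (+-identityʳ (C₂ s))
C₂-run-≥ s (j ∷ π) = begin
  C₂ s + (time₂ j + sum (map time₂ π))  ≡⟨ +-assoc (C₂ s) _ _ ⟨
  C₂ s + time₂ j + sum (map time₂ π)    ≤⟨ +-monoˡ-≤ _ (C₂-step-≥ s j) ⟩
  C₂ (step s j) + sum (map time₂ π)     ≤⟨ C₂-run-≥ (step s j) π ⟩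
  C₂ (run (step s j) π)                 ∎
  where open ≤-Reasoning

front-step-≤ : ∀ s j → front (step s j) ≤ front s + workload j
front-step-≤ (c₁ , c₂ , _) (p₁ , p₂ , _) = ⊔-lub d₁≤ d₂≤
  where
  d₁⊔c₂≤ : (c₁ + p₁) ⊔ c₂ ≤ c₁ ⊔ c₂ + p₁
  d₁⊔c₂≤ = ⊔-lub (+-monoˡ-≤ p₁ (m≤m⊔n c₁ c₂)) (≤-trans (m≤n⊔m c₁ c₂) (m≤m+n _ p₁))

  d₂≤ : (c₁ + p₁) ⊔ c₂ + p₂ ≤ c₁ ⊔ c₂ + (p₁ + p₂)
  d₂≤ = ≤-trans (+-monoˡ-≤ p₂ d₁⊔c₂≤) (≤-reflexive (+-assoc _ p₁ p₂))

  d₁≤ : c₁ + p₁ ≤ c₁ ⊔ c₂ + (p₁ + p₂)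
  d₁≤ = ≤-trans (≤-trans (m≤m⊔n _ c₂) (m≤m+n _ p₂)) d₂≤

front-run-≤ : ∀ s π → front (run s π) ≤ front s + sum (map workload π)
front-run-≤ s []      = m≤m+n (front s) 0
front-run-≤ s (j ∷ π) = begin
  front (run (step s j) π)                    ≤⟨ front-run-≤ (step s j) π ⟩
  front (step s j) + sum (map workload π)     ≤⟨ +-monoˡ-≤ _ (front-step-≤ s j) ⟩
  front s + workload j + sum (map workload π) ≡⟨ +-assoc (front s) _ _ ⟩
  front s + sum (map workload (j ∷ π))        ∎
  where open ≤-Reasoning

C₂-schedule-bounds : ∀ π →
  sum (map time₂ π) ≤ C₂ (schedule π) × C₂ (schedule π) ≤ sum (map workload π)
C₂-schedule-bounds π =
  C₂-run-≥ (0 , 0 , 0) π , ≤-trans (m≤n⊔m _ _) (front-run-≤ (0 , 0 , 0) π)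

criteria-C₂ : ∀ π → proj₁ (criteria π) ≡ C₂ (schedule π)
criteria-C₂ π with schedule π
... | _ = refl

sum-workload-≤ : ∀ {M} S → All (Bounded M) S →
  sum (map workload S) ≤ sum (map time₂ S) + length S * M
sum-workload-≤ []                  []                           = ≤-refl
sum-workload-≤ {M} ((p₁ , p₂ , _) ∷ S) ((p₁≤M , _) ∷ bounded) = begin
  p₁ + p₂ + sum (map workload S)        ≤⟨ +-mono-≤ (≤-reflexive (+-comm p₁ p₂))
                                                     (sum-workload-≤ S bounded) ⟩
  p₂ + p₁ + (T + length S * M)          ≡⟨ interchange p₂ p₁ T _ ⟩
  p₂ + T + (p₁ + length S * M)          ≤⟨ +-monoʳ-≤ (p₂ + T) (+-monoˡ-≤ (length S * M) p₁≤M) ⟩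
  p₂ + T + (M + length S * M)           ∎
  where
  open ≤-Reasoning
  T : ℕ
  T = sum (map time₂ S)

criteria₁-range : ∀ {M S} → All (Bounded M) S → ∀ {v} → ParetoVector S v →
  sum (map time₂ S) ≤ proj₁ v × proj₁ v ≤ sum (map time₂ S) + length S * M
criteria₁-range {S = S} bounded ((π , π↭S , refl) , _)
  rewrite criteria-C₂ π
  with lower , upper ← C₂-schedule-bounds π =
  subst (_≤ C₂ (schedule π)) (sum-↭ (↭.map⁺ time₂ π↭S)) lower ,
  ≤-trans upper (≤-trans (≤-reflexive (sum-↭ (↭.map⁺ workload π↭S)))
                         (sum-workload-≤ S bounded))

pareto-not-dominated : ∀ {S v w} → ParetoVector S v → ParetoVector S w → ¬ Dominates v w
pareto-not-dominated ((π , π↭S , refl) , _) (_ , undominated) = undominated π π↭S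

pareto-injective₁ : ∀ {S v w} → ParetoVector S v → ParetoVector S w → proj₁ v ≡ proj₁ w → v ≡ w
pareto-injective₁ {v = a , b} {w = _ , d} pv pw refl with b ≟ d | ≤-total b d
... | yes b≡d | _        = cong (a ,_) b≡d
... | no b≢d  | inj₁ b≤d = ⊥-elim (pareto-not-dominated pv pw (≤-refl , b≤d , b≢d ∘ cong proj₂))
... | no b≢d  | inj₂ d≤b = ⊥-elim (pareto-not-dominated pw pv (≤-refl , d≤b , b≢d ∘ sym ∘ cong proj₂))

lemma2p2 : (M : ℕ) → 1 ≤ M → (S : List Job) → All (Bounded M) S →
    (L : List (ℕ × ℕ)) → Unique L → All (ParetoVector S) L →
    length L ≤ suc (length S) * M
lemma2p2 M 1≤M S bounded L L! pareto = begin
  length L               ≡⟨ length-map offset L ⟨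
  length (map offset L)  ≤⟨ unique-<-length (map⁺-injectiveOn offset-injective pareto L!)
                                            (map⁺ (All.map offset< pareto)) ⟩
  suc (length S * M)     ≤⟨ +-monoˡ-≤ (length S * M) 1≤M ⟩
  suc (length S) * M     ∎
  where
  open ≤-Reasoning
  base : ℕ
  base = sum (map time₂ S)

  offset : ℕ × ℕ → ℕ
  offset v = proj₁ v ∸ base

  offset< : ∀ {v} → ParetoVector S v → offset v < suc (length S * M)
  offset< pv = s≤s (≤-trans (∸-monoˡ-≤ base (proj₂ (criteria₁-range bounded pv)))
                            (≤-reflexive (m+n∸m≡n base _)))

  offset-injective : ∀ {v w} → ParetoVector S v → ParetoVector S w → offset v ≡ offset w → v ≡ w
  offset-injective pv pw = pareto-injective₁ pv pw
    ∘ ∸-cancelʳ-≡ (proj₁ (criteria₁-range bounded pv)) (proj₁ (criteria₁-range bounded pw))
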